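{- For every $n\geq 0$, the number of $F$-equivalence classes of the set $\mathcal{L}_n$ of Łukasiewicz paths of length $n$ is $2^n-n$.
   Context: A Łukasiewicz path of length $n$ is a sequence of $n$ steps from $\{(1,i): i\geq -1\}$ starting at $(0,0)$, ending at $(n,0)$ and never going below the $x$-axis. Write $D=(1,-1)$, $F=(1,0)$, $U_i=(1,i)$ for $i\geq1$. Steps are numbered $1,\dots,n$; an occurrence of a pattern (one step or two consecutive steps) is at position $i$ if its first step is the $i$-th step. Two paths of the same length are $\alpha$-equivalent if the sets of occurrence positions of the pattern $\alpha$ in them are identical. -}

module Defs where

open import Data.Nat using (ℕ; zero; suc; _+_; _^_; _∸_)
open import Data.Vec using (Vec; []; _∷_; lookup)
open import Data.Fin using (Fin)
open import Data.List using (List; length)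
open import Data.List.Relation.Unary.All using (All)
open import Data.List.Relation.Unary.Any using (Any)
open import Data.List.Relation.Unary.AllPairs using (AllPairs)
open import Data.Product using (Σ; _×_)
open import Relation.Binary.PropositionalEquality using (_≡_)
open import Relation.Nullary using (¬_)
open import Function.Bundles using (_⇔_)

-- Łukasiewicz steps: D = (1,-1), F = (1,0), U i = (1, i+1)  (so U 0 is U_1).
data Step : Set where
  D : Step
  F : Step
  U : ℕ → Step

data PathFrom : ℕ → {m : ℕ} → Vec Step m → Set where
  end  : PathFrom zero []
  stepD : ∀ {h m} {s : Vec Step m} → PathFrom h s → PathFrom (suc h) (D ∷ s)
  stepF : ∀ {h m} {s : Vec Step m} → PathFrom h s → PathFrom h (F ∷ s)
  stepU : ∀ {h m i} {s : Vec Step m} → PathFrom (h + suc i) s → PathFrom h (U i ∷ s)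

IsŁuk : ∀ {n} → Vec Step n → Set
IsŁuk p = PathFrom zero p

OccF : ∀ {n} → Vec Step n → Fin n → Set
OccF p i = lookup p i ≡ F

F-equiv : ∀ {n} → Vec Step n → Vec Step n → Set
F-equiv {n} p q = (i : Fin n) → (OccF p i ⇔ OccF q i)

-- "The number of F-equivalence classes of L_n is k": there is a list of
-- Łukasiewicz paths of length n, pairwise non-equivalent (one representative
-- per class), such that every Łukasiewicz path of length n is equivalent to
-- one of them, and the list has length k.
NumFClasses : ℕ → ℕ → Set
NumFClasses n k =
  Σ (List (Vec Step n)) λ reps →
    All IsŁuk reps ×
    AllPairs (λ p q → ¬ F-equiv p q) reps ×
    ((p : Vec Step n) → IsŁuk p → Any (F-equiv p) reps) ×
    length reps ≡ k

-- F-equivalence classes correspond to F-patterns: Boolean words marking the flat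
-- steps. A word b is the F-pattern of a Łukasiewicz path iff b does not have
-- exactly one non-flat position. From height 0 the first non-flat step is an
-- up-step U_i, after which at least i + 1 ≥ 1 non-flat steps must follow;
-- conversely, an up-step to the number of remaining non-flat positions followed
-- by down-steps realises b. So the classes are counted by 2^n − (n choose 1).
module Submission where

open import Defs
open import Data.Nat using (ℕ; zero; suc; pred; _+_; _^_; _∸_; _≤_; z≤n; s≤s)
open import Data.Nat.Properties using (+-comm; +-identityʳ; m+n∸n≡m; suc-injective; ≤-trans; m≤m+n; m≤n⇒m≤1+n; +-commutativeSemigroup)
open import Data.Nat.Combinatorics using (_C_; nC1≡n; nCk+nC[k+1]≡[n+1]C[k+1])
open import Algebra.Properties.CommutativeSemigroup +-commutativeSemigroup using (interchange)
open import Data.Bool using (Bool; true; false)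
open import Data.Bool.Properties using (⇔→≡)
open import Data.Vec using (Vec; []; _∷_; map)
open import Data.Vec.Properties using (∷-injectiveˡ; ∷-injectiveʳ)
open import Data.Fin using () renaming (zero to fzero; suc to fsuc)
open import Data.List as List using (List; length; _++_)
open import Data.List.Properties using (length-++; length-map)
open import Data.List.Relation.Unary.All as All using (All)
import Data.List.Relation.Unary.All.Properties as All
open import Data.List.Relation.Unary.Any as Any using (Any; here)
import Data.List.Relation.Unary.Any.Properties as Any
open import Data.List.Relation.Unary.AllPairs as AllPairs using (AllPairs)
import Data.List.Relation.Unary.AllPairs.Properties as AllPairs
open import Data.List.Relation.Unary.Unique.Propositional using (Unique)
import Data.List.Relation.Unary.Unique.Propositional.Properties as Unique
open import Data.List.Membership.Propositional using (_∈_)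
open import Data.List.Membership.Propositional.Properties using (∈-map⁺; ∈-++⁺ˡ; ∈-++⁺ʳ)
open import Data.Product using (_,_)
open import Data.Empty using (⊥-elim)
open import Function using (_∘_)
open import Function.Bundles using (_⇔_; mk⇔; Equivalence)
import Function.Properties.Equivalence as ⇔
open import Relation.Nullary using (¬_)
open import Relation.Binary.PropositionalEquality using (_≡_; _≢_; refl; sym; trans; cong; cong₂; subst; module ≡-Reasoning)

isF : Step → Bool
isF D     = false
isF F     = true
isF (U _) = false

isF≡true⇔≡F : ∀ {x} → isF x ≡ true ⇔ x ≡ F
isF≡true⇔≡F {D}   = mk⇔ (λ ()) (λ ())
isF≡true⇔≡F {F}   = mk⇔ (λ _ → refl) (λ _ → refl)
isF≡true⇔≡F {U _} = mk⇔ (λ ()) (λ ())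

≡F⇔≡F⇒same-isF : ∀ {x y} → (x ≡ F ⇔ y ≡ F) → isF x ≡ isF y
≡F⇔≡F⇒same-isF x⇔y = ⇔→≡ (⇔.trans isF≡true⇔≡F (⇔.trans x⇔y (⇔.sym isF≡true⇔≡F)))

same-isF⇒≡F⇔≡F : ∀ {x y} → isF x ≡ isF y → (x ≡ F ⇔ y ≡ F)
same-isF⇒≡F⇔≡F {y = y} eq =
  ⇔.trans (⇔.sym isF≡true⇔≡F) (subst (λ b → b ≡ true ⇔ y ≡ F) (sym eq) isF≡true⇔≡F)

F-pattern : ∀ {n} → Vec Step n → Vec Bool n
F-pattern = map isF

F-equiv⇔same-F-pattern : ∀ {n} (p q : Vec Step n) → F-equiv p q ⇔ F-pattern p ≡ F-pattern q
F-equiv⇔same-F-pattern p q = mk⇔ (to p q) (from p q)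
  where
  to : ∀ {n} (p q : Vec Step n) → F-equiv p q → F-pattern p ≡ F-pattern q
  to []      []      _  = refl
  to (x ∷ p) (y ∷ q) pq = cong₂ _∷_ (≡F⇔≡F⇒same-isF (pq fzero)) (to p q (pq ∘ fsuc))

  from : ∀ {n} (p q : Vec Step n) → F-pattern p ≡ F-pattern q → F-equiv p q
  from (x ∷ p) (y ∷ q) eq fzero    = same-isF⇒≡F⇔≡F (∷-injectiveˡ eq)
  from (x ∷ p) (y ∷ q) eq (fsuc i) = from p q (∷-injectiveʳ eq) i

#false : ∀ {n} → Vec Bool n → ℕ
#false []          = 0
#false (true  ∷ b) = #false b
#false (false ∷ b) = suc (#false b)

fromPattern : ∀ {n} → ℕ → Vec Bool n → Vec Step n
fromPattern h       []          = []
fromPattern h       (true  ∷ b) = F ∷ fromPattern h b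
fromPattern zero    (false ∷ b) = U (pred (#false b)) ∷ fromPattern (#false b) b
fromPattern (suc h) (false ∷ b) = D ∷ fromPattern h b

F-pattern-fromPattern : ∀ {n} h (b : Vec Bool n) → F-pattern (fromPattern h b) ≡ b
F-pattern-fromPattern h       []          = refl
F-pattern-fromPattern h       (true  ∷ b) = cong (true ∷_) (F-pattern-fromPattern h b)
F-pattern-fromPattern zero    (false ∷ b) = cong (false ∷_) (F-pattern-fromPattern (#false b) b)
F-pattern-fromPattern (suc h) (false ∷ b) = cong (false ∷_) (F-pattern-fromPattern h b)

fromPattern-descends : ∀ {n} h (b : Vec Bool n) → #false b ≡ h → PathFrom h (fromPattern h b)
fromPattern-descends .zero []          refl = end
fromPattern-descends h     (true  ∷ b) eq   = stepF (fromPattern-descends h b eq)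
fromPattern-descends (suc h) (false ∷ b) eq = stepD (fromPattern-descends h b (suc-injective eq))

fromPattern-isŁuk : ∀ {n} (b : Vec Bool n) → #false b ≢ 1 → IsŁuk (fromPattern 0 b)
fromPattern-isŁuk []          _  = end
fromPattern-isŁuk (true  ∷ b) ≢1 = stepF (fromPattern-isŁuk b ≢1)
fromPattern-isŁuk (false ∷ b) ≢1 with #false b in eq
... | zero  = ⊥-elim (≢1 refl)
... | suc k = stepU (fromPattern-descends (suc k) b eq)

height≤#false : ∀ {h m} {s : Vec Step m} → PathFrom h s → h ≤ #false (F-pattern s)
height≤#false end                   = z≤n
height≤#false (stepD q)             = s≤s (height≤#false q)
height≤#false (stepF q)             = height≤#false q
height≤#false {h} (stepU {i = i} q) = m≤n⇒m≤1+n (≤-trans (m≤m+n h (suc i)) (height≤#false q))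

#false≢1 : ∀ {m} {s : Vec Step m} → IsŁuk s → #false (F-pattern s) ≢ 1
#false≢1 (stepF q) = #false≢1 q
#false≢1 (stepU q) eq with subst (_ ≤_) (suc-injective eq) (height≤#false q)
... | ()

F-equiv-fromPattern⇒≡ : ∀ {n} h h′ {b c : Vec Bool n} → F-equiv (fromPattern h b) (fromPattern h′ c) → b ≡ c
F-equiv-fromPattern⇒≡ h h′ {b} {c} e = begin
  b                             ≡⟨ sym (F-pattern-fromPattern h b) ⟩
  F-pattern (fromPattern h b)   ≡⟨ Equivalence.to (F-equiv⇔same-F-pattern _ _) e ⟩
  F-pattern (fromPattern h′ c)  ≡⟨ F-pattern-fromPattern h′ c ⟩
  c                             ∎
  where open ≡-Reasoning

prefixed : ∀ {n} → List (Vec Bool n) → List (Vec Bool n) → List (Vec Bool (suc n))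
prefixed xs ys = List.map (true ∷_) xs ++ List.map (false ∷_) ys

length-prefixed : ∀ {n} (xs ys : List (Vec Bool n)) → length (prefixed xs ys) ≡ length xs + length ys
length-prefixed xs ys = trans (length-++ (List.map (true ∷_) xs))
  (cong₂ _+_ (length-map (true ∷_) xs) (length-map (false ∷_) ys))

prefixed⁺ : ∀ {n} {P : Vec Bool (suc n) → Set} {xs ys} →
            All (P ∘ (true ∷_)) xs → All (P ∘ (false ∷_)) ys → All P (prefixed xs ys)
prefixed⁺ Pxs Pys = All.++⁺ (All.map⁺ Pxs) (All.map⁺ Pys)

∈-prefixedˡ : ∀ {n} {v : Vec Bool n} {xs} ys → v ∈ xs → true ∷ v ∈ prefixed xs ys
∈-prefixedˡ ys v∈xs = ∈-++⁺ˡ (∈-map⁺ (true ∷_) v∈xs)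

∈-prefixedʳ : ∀ {n} {v : Vec Bool n} xs {ys} → v ∈ ys → false ∷ v ∈ prefixed xs ys
∈-prefixedʳ xs v∈ys = ∈-++⁺ʳ (List.map (true ∷_) xs) (∈-map⁺ (false ∷_) v∈ys)

unique-prefixed : ∀ {n} {xs ys : List (Vec Bool n)} → Unique xs → Unique ys → Unique (prefixed xs ys)
unique-prefixed {xs = xs} {ys} !xs !ys = AllPairs.++⁺
  (Unique.map⁺ ∷-injectiveʳ !xs)
  (Unique.map⁺ ∷-injectiveʳ !ys)
  (All.map⁺ (All.universal (λ _ → All.map⁺ (All.universal (λ _ ()) ys)) xs))

allVecs : ∀ n → List (Vec Bool n)
allVecs zero    = List.[ [] ]
allVecs (suc n) = prefixed (allVecs n) (allVecs n)

∈-allVecs : ∀ {n} (v : Vec Bool n) → v ∈ allVecs n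
∈-allVecs []          = here refl
∈-allVecs (true  ∷ v) = ∈-prefixedˡ (allVecs _) (∈-allVecs v)
∈-allVecs (false ∷ v) = ∈-prefixedʳ (allVecs _) (∈-allVecs v)

unique-allVecs : ∀ n → Unique (allVecs n)
unique-allVecs zero    = All.[] AllPairs.∷ AllPairs.[]
unique-allVecs (suc n) = unique-prefixed (unique-allVecs n) (unique-allVecs n)

length-allVecs : ∀ n → length (allVecs n) ≡ 2 ^ n
length-allVecs zero    = refl
length-allVecs (suc n) = trans (length-prefixed (allVecs n) (allVecs n))
  (cong₂ _+_ (length-allVecs n) (trans (length-allVecs n) (sym (+-identityʳ (2 ^ n)))))

avoiding : ℕ → ∀ n → List (Vec Bool n)
avoiding zero    zero    = List.[]
avoiding (suc k) zero    = List.[ [] ]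
avoiding zero    (suc n) = prefixed (avoiding zero n) (allVecs n)
avoiding (suc k) (suc n) = prefixed (avoiding (suc k) n) (avoiding k n)

avoiding-sound : ∀ k n → All (λ v → #false v ≢ k) (avoiding k n)
avoiding-sound zero    zero    = All.[]
avoiding-sound (suc k) zero    = (λ ()) All.∷ All.[]
avoiding-sound zero    (suc n) = prefixed⁺ (avoiding-sound zero n) (All.universal (λ _ ()) (allVecs n))
avoiding-sound (suc k) (suc n) =
  prefixed⁺ (avoiding-sound (suc k) n) (All.map (λ ≢k → ≢k ∘ suc-injective) (avoiding-sound k n))

∈-avoiding : ∀ {k n} (v : Vec Bool n) → #false v ≢ k → v ∈ avoiding k n
∈-avoiding {zero}  []          ≢k = ⊥-elim (≢k refl)
∈-avoiding {suc k} []          _  = here refl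
∈-avoiding {zero}  (true  ∷ v) ≢k = ∈-prefixedˡ (allVecs _) (∈-avoiding v ≢k)
∈-avoiding {zero}  (false ∷ v) _  = ∈-prefixedʳ (avoiding zero _) (∈-allVecs v)
∈-avoiding {suc k} (true  ∷ v) ≢k = ∈-prefixedˡ (avoiding k _) (∈-avoiding v ≢k)
∈-avoiding {suc k} (false ∷ v) ≢k = ∈-prefixedʳ (avoiding (suc k) _) (∈-avoiding v (≢k ∘ cong suc))

unique-avoiding : ∀ k n → Unique (avoiding k n)
unique-avoiding zero    zero    = AllPairs.[]
unique-avoiding (suc k) zero    = All.[] AllPairs.∷ AllPairs.[]
unique-avoiding zero    (suc n) = unique-prefixed (unique-avoiding zero n) (unique-allVecs n)
unique-avoiding (suc k) (suc n) = unique-prefixed (unique-avoiding (suc k) n) (unique-avoiding k n)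

length-avoiding : ∀ k n → length (avoiding k n) + n C k ≡ 2 ^ n
-- Both sides of each equation are stated as Agda unfolds them: suc n C 0 to 1,
-- and 2 ^ suc n to 2 ^ n + (2 ^ n + 0).
length-avoiding zero    zero    = refl
length-avoiding (suc k) zero    = refl
length-avoiding zero    (suc n) = begin
  length (prefixed a all) + 1         ≡⟨ cong (_+ 1) (length-prefixed a all) ⟩
  (length a + length all) + (1 + 0)   ≡⟨ interchange (length a) (length all) 1 0 ⟩
  (length a + 1) + (length all + 0)   ≡⟨ cong₂ _+_ (length-avoiding zero n) (cong (_+ 0) (length-allVecs n)) ⟩
  2 ^ n + (2 ^ n + 0)                 ∎
  where
  open ≡-Reasoning
  a all : List (Vec Bool n)
  a   = avoiding zero n
  all = allVecs n
length-avoiding (suc k) (suc n) = begin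
  length (prefixed a₁ a₀) + suc n C suc k         ≡⟨ cong₂ _+_ (length-prefixed a₁ a₀) pascal ⟩
  (length a₁ + length a₀) + (n C suc k + n C k)   ≡⟨ interchange (length a₁) (length a₀) _ _ ⟩
  (length a₁ + n C suc k) + (length a₀ + n C k)   ≡⟨ cong₂ _+_ (length-avoiding (suc k) n) (length-avoiding k n) ⟩
  2 ^ n + 2 ^ n                                   ≡⟨ cong (2 ^ n +_) (+-identityʳ (2 ^ n)) ⟨
  2 ^ n + (2 ^ n + 0)                             ∎
  where
  open ≡-Reasoning
  a₁ a₀ : List (Vec Bool n)
  a₁ = avoiding (suc k) n
  a₀ = avoiding k n
  pascal : suc n C suc k ≡ n C suc k + n C k
  pascal = trans (sym (nCk+nC[k+1]≡[n+1]C[k+1] n k)) (+-comm (n C k) (n C suc k))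

Łuk-representatives : ∀ n → List (Vec Step n)
Łuk-representatives n = List.map (fromPattern 0) (avoiding 1 n)

length-avoiding-1 : ∀ n → length (avoiding 1 n) ≡ 2 ^ n ∸ n
length-avoiding-1 n = begin
  length (avoiding 1 n)              ≡⟨ m+n∸n≡m (length (avoiding 1 n)) n ⟨
  length (avoiding 1 n) + n ∸ n      ≡⟨ cong (λ m → length (avoiding 1 n) + m ∸ n) (nC1≡n n) ⟨
  length (avoiding 1 n) + n C 1 ∸ n  ≡⟨ cong (_∸ n) (length-avoiding 1 n) ⟩
  2 ^ n ∸ n                          ∎
  where open ≡-Reasoning

fromPattern-pairwise-inequivalent : ∀ {n} h {bs : List (Vec Bool n)} → Unique bs →
  AllPairs (λ p q → ¬ F-equiv p q) (List.map (fromPattern h) bs)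
fromPattern-pairwise-inequivalent h !bs =
  AllPairs.map⁺ (AllPairs.map (λ b≢c → b≢c ∘ F-equiv-fromPattern⇒≡ h h) !bs)

F-equiv-fromPattern-F-pattern : ∀ {n} h (p : Vec Step n) → F-equiv p (fromPattern h (F-pattern p))
F-equiv-fromPattern-F-pattern h p = Equivalence.from (F-equiv⇔same-F-pattern p _)
  (sym (F-pattern-fromPattern h (F-pattern p)))

F-equiv-representative : ∀ {n} (p : Vec Step n) → IsŁuk p → Any (F-equiv p) (Łuk-representatives n)
F-equiv-representative p p-isŁuk = Any.map⁺ (Any.map
  (λ { refl → F-equiv-fromPattern-F-pattern 0 p })
  (∈-avoiding (F-pattern p) (#false≢1 p-isŁuk)))

theorem2 : (n : ℕ) → NumFClasses n (2 ^ n ∸ n)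
theorem2 n = Łuk-representatives n
  , All.map⁺ (All.map (fromPattern-isŁuk _) (avoiding-sound 1 n))
  , fromPattern-pairwise-inequivalent 0 (unique-avoiding 1 n)
  , F-equiv-representative
  , trans (length-map (fromPattern 0) (avoiding 1 n)) (length-avoiding-1 n)
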